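{- Let $p,q$ be positive integers with $p/q\ge2$, let $G$ be a connected graph with a fixed orientation, and let $f,g$ be two $(p,q)$-colourings of $G$. Then there is a sequence of $(p,q)$-colourings $f,f_1,f_2,\dots,f_n$ of $G$, each obtained from its predecessor by a vertex set recolouring, such that for some constant $k$ we have $f_n(v)\equiv g(v)+k\pmod p$ for all vertices $v$, if and only if $\varphi_f(C)=\varphi_g(C)$ for all cycles $C$ of $G$.
   Context: A $(p,q)$-colouring of $G$ is a map $f:V(G)\to\{0,\dots,p-1\}$ with $q\le|f(u)-f(v)|\le p-q$ for every edge $uv$. The induced edge-labelling is $\varphi_f(e)=f(v)-f(u)\bmod p$ for $e$ oriented from $u$ to $v$; for a cycle $C$ with a chosen direction of traversal, $\varphi_f(C)=\sum_{e\text{ forward}}\varphi_f(e)+\sum_{e\text{ backward}}(p-\varphi_f(e))$ (sum in $\mathbb{Z}$). For $\emptyset\ne X\subsetneq V(G)$, $\partial^+(X)$ ($\partial^-(X)$) is the set of edges oriented from $X$ to $V(G)\setminus X$ (resp. from $V(G)\setminus X$ to $X$). A vertex set recolouring of $f$ replaces $f$ by $f'$ where $f'(v)=f(v)+\alpha\bmod p$ for $v\in X$ and $f'(v)=f(v)$ otherwise, for some $\emptyset\neq X\subsetneq V(G)$ and integer $1\le\alpha\le p-1$ such that $\varphi_f(e)\ge q+\alpha$ for all $e\in\partial^+(X)$ and $\varphi_f(e)\le p-q-\alpha$ for all $e\in\partial^-(X)$ (which guarantees $f'$ is a $(p,q)$-colouring). -}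

module Defs where

open import Data.Nat using (ℕ; zero; suc; _+_; _*_; _∸_; _≤_; _%_; ∣_-_∣; NonZero)
open import Data.Fin using (Fin; toℕ)
open import Data.Bool using (Bool; true; false; if_then_else_; _∨_)
open import Data.List using (List; []; _∷_; zip; _∷ʳ_; length; map)
open import Data.Nat.ListAction using (sum)
open import Data.List.Relation.Unary.All using (All)
open import Data.List.Relation.Unary.Unique.Propositional using (Unique)
open import Data.Product using (Σ; ∃; _×_; _,_)
open import Relation.Binary.PropositionalEquality using (_≡_)
open import Relation.Binary.Construct.Closure.ReflexiveTransitive using (Star)
open import Relation.Nullary using (¬_)

-- A finite simple graph on vertex set Fin n, given together with a fixed
-- orientation: Arc u v ≡ true means the edge {u,v} is oriented from u to v.
record OrientedGraph : Set where
  field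
    n         : ℕ
    Arc       : Fin n → Fin n → Bool
    loopless  : ∀ v → Arc v v ≡ false
    oriented  : ∀ u v → Arc u v ≡ true → Arc v u ≡ false
open OrientedGraph public

Adj : (G : OrientedGraph) → Fin (n G) → Fin (n G) → Set
Adj G u v = (Arc G u v ∨ Arc G v u) ≡ true

Connected : OrientedGraph → Set
Connected G = ∀ u v → Star (Adj G) u v

Colouring : ℕ → OrientedGraph → Set
Colouring p G = Fin (n G) → Fin p

IsPQColouring : (p q : ℕ) (G : OrientedGraph) → Colouring p G → Set
IsPQColouring p q G f = ∀ u v → Arc G u v ≡ true →
  (q ≤ ∣ toℕ (f u) - toℕ (f v) ∣) × (q + ∣ toℕ (f u) - toℕ (f v) ∣ ≤ p)

φ : (p : ℕ) .{{_ : NonZero p}} (G : OrientedGraph) → Colouring p G → Fin (n G) → Fin (n G) → ℕ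
φ p G f u v = (p + toℕ (f v) ∸ toℕ (f u)) % p

closedPairs : {A : Set} → List A → List (A × A)
closedPairs [] = []
closedPairs (x ∷ xs) = zip (x ∷ xs) (xs ∷ʳ x)

-- A cycle of G with a chosen direction of traversal: a list of at least 3
-- distinct vertices, cyclically consecutive ones adjacent.
IsCycle : (G : OrientedGraph) → List (Fin (n G)) → Set
IsCycle G C = (3 ≤ length C) × Unique C × All (λ { (a , b) → Adj G a b }) (closedPairs C)

stepValue : (p : ℕ) .{{_ : NonZero p}} (G : OrientedGraph) → Colouring p G → Fin (n G) × Fin (n G) → ℕ
stepValue p G f (a , b) = if Arc G a b then φ p G f a b else p ∸ φ p G f b a

φCycle : (p : ℕ) .{{_ : NonZero p}} (G : OrientedGraph) → Colouring p G → List (Fin (n G)) → ℕ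
φCycle p G f C = sum (map (stepValue p G f) (closedPairs C))

VertexSetRecolouring : (p q : ℕ) .{{_ : NonZero p}} (G : OrientedGraph) → Colouring p G → Colouring p G → Set
VertexSetRecolouring p q G f f' =
  Σ (Fin (n G) → Bool) λ X → Σ ℕ λ α →
    (∃ λ v → X v ≡ true) × (∃ λ v → X v ≡ false) ×
    (1 ≤ α) × (α + 1 ≤ p) ×
    (∀ u v → Arc G u v ≡ true → X u ≡ true → X v ≡ false → q + α ≤ φ p G f u v) ×
    (∀ u v → Arc G u v ≡ true → X u ≡ false → X v ≡ true → φ p G f u v + q + α ≤ p) ×
    (∀ v → toℕ (f' v) ≡ (if X v then (toℕ (f v) + α) % p else toℕ (f v)))

Reaches : (p q : ℕ) .{{_ : NonZero p}} (G : OrientedGraph) → Colouring p G → Colouring p G → Set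
Reaches p q G = Star (VertexSetRecolouring p q G)

-- A vertex set recolouring (X, α) lowers the label of every arc leaving X by α and raises the label of
-- every arc entering X by α; along a closed walk these changes telescope, so cycle values are
-- invariant, and a constant shift of all colours changes no label at all.
--
-- Conversely, equality on cycles extends to all closed walks, since a closed walk with a repeated
-- vertex splits into two shorter ones. Comparing label sums along fixed walks r → x → r for f and g
-- then gives a potential h with φ_g(uv) + h(u) = φ_f(uv) + h(v) on every arc uv. Recolouring the set
-- where h is maximal by +1 is a legal vertex set recolouring: on an arc leaving that set
-- φ_f(uv) > φ_g(uv) ≥ q, and on an arc entering it φ_f(uv) < φ_g(uv) ≤ p − q. It lowers the maximum of
-- h by one, so after finitely many steps h is constant, the labels of f and g agree, and connectivity
-- makes the colourings differ by a constant.

module Submission where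

open import Defs
open import Data.Bool using (Bool; true; false; if_then_else_; _∨_; T)
open import Data.Empty using (⊥-elim)
open import Data.Unit using (tt)
open import Data.Fin using (Fin; zero; suc; toℕ; fromℕ<)
open import Data.Fin.Properties using (toℕ<n; toℕ-fromℕ<; all?; any?; ¬∀⟶∃¬)
open import Data.List using (List; []; _∷_; _++_; _∷ʳ_; zip; map; length)
open import Data.List.Properties using (map-++; map-cong; length-++; length-++-sucʳ)
open import Data.List.Membership.Propositional.Properties using (∈-∃++)
open import Data.List.Relation.Binary.Permutation.Propositional using (_↭_; ↭-reflexive; module PermutationReasoning)
open import Data.List.Relation.Binary.Permutation.Propositional.Properties using (shifts; map⁺; ↭-length; All-resp-↭)
open import Data.List.Relation.Unary.All as All using (All; []; _∷_)
open import Data.List.Relation.Unary.All.Properties using (++⁻; ¬Any⇒All¬)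
open import Data.List.Relation.Unary.Unique.Propositional using (Unique)
import Data.List.Relation.Unary.AllPairs as AllPairs
open import Data.Nat using (ℕ; zero; suc; _+_; _*_; _∸_; _≤_; _<_; _%_; _≡ᵇ_; z≤n; s≤s; z<s; NonZero)
open import Data.Nat.DivMod using (m%n<n; m%n%n≡m%n; [m+n]%n≡m%n; %-distribˡ-+; m<n⇒m%n≡m)
open import Data.Nat.ListAction using (sum)
open import Data.Nat.ListAction.Properties using (sum-++; sum-↭)
open import Data.Nat.Properties
open import Data.Nat.Tactic.RingSolver using (solve-∀)
open import Algebra.Properties.CommutativeSemigroup +-commutativeSemigroup using (xy∙z≈xz∙y; xy∙z≈yz∙x; x∙yz≈xz∙y)
open import Data.Product using (Σ; ∃-syntax; _×_; _,_; proj₁; proj₂; uncurry)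
open import Data.Sum using (_⊎_; inj₁; inj₂)
open import Function.Bundles using (_⇔_; mk⇔)
open import Relation.Binary.Construct.Closure.ReflexiveTransitive using (Star; ε; _◅_; _◅◅_)
open import Relation.Binary.Definitions using (DecidableEquality)
open import Relation.Binary.PropositionalEquality
open import Relation.Nullary using (¬_; yes; no)
open import Relation.Nullary.Decidable using (dec-true; dec-false)

infix 4 _≡_mod_
_≡_mod_ : ℕ → ℕ → (p : ℕ) → .{{NonZero p}} → Set
_≡_mod_ a b p = a % p ≡ b % p

module _ {p : ℕ} .{{_ : NonZero p}} where

  +-cong-mod : ∀ {a b c d} → a ≡ b mod p → c ≡ d mod p → a + c ≡ b + d mod p
  +-cong-mod {a} {b} {c} {d} a≡b c≡d = begin
    (a + c) % p          ≡⟨ %-distribˡ-+ a c p ⟩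
    (a % p + c % p) % p  ≡⟨ cong₂ (λ x y → (x + y) % p) a≡b c≡d ⟩
    (b % p + d % p) % p  ≡⟨ sym (%-distribˡ-+ b d p) ⟩
    (b + d) % p          ∎
    where open ≡-Reasoning

  %-mod : ∀ a → a % p ≡ a mod p
  %-mod a = m%n%n≡m%n a p

  p+-mod : ∀ a → p + a ≡ a mod p
  p+-mod a = trans (cong (_% p) (+-comm p a)) ([m+n]%n≡m%n a p)

  +-cancelʳ-mod : ∀ c {a b} → a + c ≡ b + c mod p → a ≡ b mod p
  +-cancelʳ-mod c {a} {b} e = begin
    a % p                       ≡⟨ sym (undo a) ⟩
    (a + c + (p ∸ c % p)) % p   ≡⟨ +-cong-mod e refl ⟩
    (b + c + (p ∸ c % p)) % p   ≡⟨ undo b ⟩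
    b % p                       ∎
    where
    open ≡-Reasoning
    undo : ∀ x → x + c + (p ∸ c % p) ≡ x mod p
    undo x = begin
      (x + c + (p ∸ c % p)) % p        ≡⟨ +-cong-mod (+-cong-mod {a = x} refl (sym (%-mod c))) refl ⟩
      (x + c % p + (p ∸ c % p)) % p    ≡⟨ cong (_% p) (+-assoc x (c % p) _) ⟩
      (x + (c % p + (p ∸ c % p))) % p  ≡⟨ cong (λ y → (x + y) % p) (m+[n∸m]≡n (<⇒≤ (m%n<n c p))) ⟩
      (x + p) % p                      ≡⟨ [m+n]%n≡m%n x p ⟩
      x % p                            ∎

  mod-injective : ∀ {a b} → a < p → b < p → a ≡ b mod p → a ≡ b
  mod-injective a<p b<p e = trans (sym (m<n⇒m%n≡m a<p)) (trans e (m<n⇒m%n≡m b<p))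

m+1+o≡n+k⇒k≤o⇒m<n : ∀ {m n k o} → m + suc o ≡ n + k → k ≤ o → m < n
m+1+o≡n+k⇒k≤o⇒m<n {m} {n} {k} {o} e k≤o = +-cancelʳ-≤ o (suc m) n (begin
  suc m + o  ≡⟨ sym (+-suc m o) ⟩
  m + suc o  ≡⟨ e ⟩
  n + k      ≤⟨ +-monoʳ-≤ n k≤o ⟩
  n + o      ∎)
  where open ≤-Reasoning

complement-exchange : ∀ {p x y c d} → x + c ≡ y + d → x ≤ p → y ≤ p → p ∸ x + d ≡ p ∸ y + c
complement-exchange {p} {x} {y} {c} {d} e x≤p y≤p = +-cancelʳ-≡ x _ _ (begin
  p ∸ x + d + x    ≡⟨ xy∙z≈xz∙y (p ∸ x) d x ⟩
  p ∸ x + x + d    ≡⟨ cong (_+ d) (m∸n+n≡m x≤p) ⟩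
  p + d            ≡⟨ cong (_+ d) (sym (m∸n+n≡m y≤p)) ⟩
  p ∸ y + y + d    ≡⟨ +-assoc (p ∸ y) y d ⟩
  p ∸ y + (y + d)  ≡⟨ cong (p ∸ y +_) (sym e) ⟩
  p ∸ y + (x + c)  ≡⟨ x∙yz≈xz∙y (p ∸ y) x c ⟩
  p ∸ y + c + x    ∎)
  where open ≡-Reasoning

-- ℓ: the label of an arc uv; o, i: label sums along chosen walks r → x and x → r, at x = u or v;
-- a + ofu = b + ofv is the common offset.
potential-arith : ∀ ℓf ℓg ofu ogu ofv ogv ifv igv a b →
  ofu + (ℓf + ifv) ≡ ogu + (ℓg + igv) → ofv + ifv ≡ ogv + igv → a + ofu ≡ b + ofv →
  ℓg + (ogu + a) ≡ ℓf + (ogv + b)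
potential-arith ℓf ℓg ofu ogu ofv ogv ifv igv a b via-arc via-v a+ofu≡b+ofv =
  +-cancelʳ-≡ (ofu + (ofv + ifv)) _ _ (begin
    ℓg + (ogu + a) + (ofu + (ofv + ifv))   ≡⟨ regroup₁ ℓg ogu a ofu ofv ifv ⟩
    ℓg + ogu + (a + ofu) + (ofv + ifv)     ≡⟨ cong₂ (λ x y → ℓg + ogu + x + y) a+ofu≡b+ofv via-v ⟩
    ℓg + ogu + (b + ofv) + (ogv + igv)     ≡⟨ regroup₂ ℓg ogu b ofv ogv igv ⟩
    ogv + b + ofv + (ogu + (ℓg + igv))     ≡⟨ cong (ogv + b + ofv +_) (sym via-arc) ⟩
    ogv + b + ofv + (ofu + (ℓf + ifv))     ≡⟨ regroup₃ ogv b ofv ofu ℓf ifv ⟩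
    ℓf + (ogv + b) + (ofu + (ofv + ifv))   ∎)
  where
  open ≡-Reasoning
  regroup₁ : ∀ x y z u v w → x + (y + z) + (u + (v + w)) ≡ x + y + (z + u) + (v + w)
  regroup₁ = solve-∀
  regroup₂ : ∀ x y z u v w → x + y + (z + u) + (v + w) ≡ v + z + u + (y + (x + w))
  regroup₂ = solve-∀
  regroup₃ : ∀ x y z u v w → x + y + z + (u + (v + w)) ≡ v + (x + y) + (u + (z + w))
  regroup₃ = solve-∀

∃-upper-bound : ∀ {m} (h : Fin m → ℕ) → ∃[ K ] ∀ i → h i ≤ K
∃-upper-bound {zero} h = 0 , λ ()
∃-upper-bound {suc m} h with ∃-upper-bound (λ i → h (suc i))
... | K , bound = h zero + K , λ where
  zero    → m≤m+n (h zero) K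
  (suc i) → ≤-trans (bound i) (m≤n+m K (h zero))

inhabited⊎empty : ∀ m → Fin m ⊎ ¬ Fin m
inhabited⊎empty zero    = inj₂ λ ()
inhabited⊎empty (suc m) = inj₁ zero

module _ {A : Set} where

  walkPairs : A → List A → A → List (A × A)
  walkPairs x xs z = zip (x ∷ xs) (xs ∷ʳ z)

  walkPairs-++ : ∀ x xs y ys z → walkPairs x (xs ++ y ∷ ys) z ≡ walkPairs x xs y ++ walkPairs y ys z
  walkPairs-++ x []        y ys z = refl
  walkPairs-++ x (x′ ∷ xs) y ys z = cong ((x , x′) ∷_) (walkPairs-++ x′ xs y ys z)

  closedPairs-split : ∀ xs y ys zs →
    closedPairs (xs ++ y ∷ ys ++ y ∷ zs) ↭ closedPairs (y ∷ ys) ++ closedPairs (xs ++ y ∷ zs)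
  closedPairs-split [] y ys zs = ↭-reflexive (walkPairs-++ y ys y zs y)
  closedPairs-split (x ∷ xs) y ys zs = begin
    walkPairs x (xs ++ y ∷ ys ++ y ∷ zs) x
      ≡⟨ walkPairs-++ x xs y (ys ++ y ∷ zs) x ⟩
    walkPairs x xs y ++ walkPairs y (ys ++ y ∷ zs) x
      ≡⟨ cong (walkPairs x xs y ++_) (walkPairs-++ y ys y zs x) ⟩
    walkPairs x xs y ++ walkPairs y ys y ++ walkPairs y zs x
      ↭⟨ shifts (walkPairs x xs y) (walkPairs y ys y) ⟩
    walkPairs y ys y ++ walkPairs x xs y ++ walkPairs y zs x
      ≡⟨ cong (walkPairs y ys y ++_) (sym (walkPairs-++ x xs y zs x)) ⟩
    walkPairs y ys y ++ walkPairs x (xs ++ y ∷ zs) x ∎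
    where open PermutationReasoning

  length-split : ∀ (xs : List A) y ys zs →
    length (xs ++ y ∷ ys ++ y ∷ zs) ≡ length (y ∷ ys) + length (xs ++ y ∷ zs)
  length-split xs y ys zs = trans (↭-length (shifts xs (y ∷ ys) {y ∷ zs})) (length-++ (y ∷ ys))

  module _ (w w′ : A × A → ℕ) (c : A → ℕ) where

    Telescopes : A × A → Set
    Telescopes (a , b) = w′ (a , b) + c a ≡ w (a , b) + c b

    sum-walkPairs-telescope : ∀ x xs z → All Telescopes (walkPairs x xs z) →
      sum (map w′ (walkPairs x xs z)) + c x ≡ sum (map w (walkPairs x xs z)) + c z
    sum-walkPairs-telescope x [] z (t ∷ []) = begin
      w′ (x , z) + 0 + c x  ≡⟨ cong (_+ c x) (+-identityʳ _) ⟩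
      w′ (x , z) + c x      ≡⟨ t ⟩
      w (x , z) + c z       ≡⟨ cong (_+ c z) (sym (+-identityʳ _)) ⟩
      w (x , z) + 0 + c z   ∎
      where open ≡-Reasoning
    sum-walkPairs-telescope x (y ∷ ys) z (t ∷ ts) = begin
      w′ (x , y) + S′ + c x    ≡⟨ xy∙z≈xz∙y (w′ (x , y)) S′ (c x) ⟩
      w′ (x , y) + c x + S′    ≡⟨ cong (_+ S′) t ⟩
      w (x , y) + c y + S′     ≡⟨ +-assoc (w (x , y)) (c y) S′ ⟩
      w (x , y) + (c y + S′)   ≡⟨ cong (w (x , y) +_) (+-comm (c y) S′) ⟩
      w (x , y) + (S′ + c y)   ≡⟨ cong (w (x , y) +_) (sum-walkPairs-telescope y ys z ts) ⟩
      w (x , y) + (S + c z)    ≡⟨ sym (+-assoc (w (x , y)) S (c z)) ⟩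
      w (x , y) + S + c z      ∎
      where
      open ≡-Reasoning
      S′ = sum (map w′ (walkPairs y ys z))
      S  = sum (map w (walkPairs y ys z))

    sum-closedPairs-telescope : ∀ xs → All Telescopes (closedPairs xs) →
      sum (map w′ (closedPairs xs)) ≡ sum (map w (closedPairs xs))
    sum-closedPairs-telescope []       _  = refl
    sum-closedPairs-telescope (x ∷ xs) ts = +-cancelʳ-≡ (c x) _ _ (sum-walkPairs-telescope x xs x ts)

  module _ (_≟_ : DecidableEquality A) where
    open import Data.List.Membership.DecPropositional _≟_ using (_∈?_)

    unique⊎repeats : ∀ xs → Unique xs ⊎ ∃[ ys ] ∃[ y ] ∃[ zs ] ∃[ ws ] xs ≡ ys ++ y ∷ zs ++ y ∷ ws
    unique⊎repeats [] = inj₁ AllPairs.[]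
    unique⊎repeats (x ∷ xs) with x ∈? xs
    ... | yes x∈xs with ∈-∃++ x∈xs
    ...   | zs , ws , xs≡ = inj₂ ([] , x , zs , ws , cong (x ∷_) xs≡)
    unique⊎repeats (x ∷ xs) | no x∉xs with unique⊎repeats xs
    ... | inj₁ unique = inj₁ (¬Any⇒All¬ xs x∉xs AllPairs.∷ unique)
    ... | inj₂ (ys , y , zs , ws , xs≡) = inj₂ (x ∷ ys , y , zs , ws , cong (x ∷_) xs≡)

module _ {A : Set} {R : A → A → Set} where

  vertices : ∀ {x y} → Star R x y → List A
  vertices ε = []
  vertices {x} (_ ◅ s) = x ∷ vertices s

  edges : ∀ {x y} → Star R x y → List (A × A)
  edges ε = []
  edges (_◅_ {x} {y} _ s) = (x , y) ∷ edges s

  edges-◅◅ : ∀ {x y z} (s : Star R x y) (t : Star R y z) → edges (s ◅◅ t) ≡ edges s ++ edges t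
  edges-◅◅ ε       t = refl
  edges-◅◅ (r ◅ s) t = cong (_ ∷_) (edges-◅◅ s t)

  edges-related : ∀ {x y} (s : Star R x y) → All (uncurry R) (edges s)
  edges-related ε       = []
  edges-related (r ◅ s) = r ∷ edges-related s

  walkPairs-vertices : ∀ u {x y} (s : Star R x y) → walkPairs u (vertices s) y ≡ (u , x) ∷ edges s
  walkPairs-vertices u ε       = refl
  walkPairs-vertices u (r ◅ s) = cong (_ ∷_) (walkPairs-vertices _ s)

  closedPairs-vertices : ∀ {x} (c : Star R x x) → closedPairs (vertices c) ≡ edges c
  closedPairs-vertices ε       = refl
  closedPairs-vertices (r ◅ s) = walkPairs-vertices _ s

module _ (p : ℕ) .{{_ : NonZero p}} (G : OrientedGraph) where

  label-spec : ∀ f u v → φ p G f u v + toℕ (f u) ≡ toℕ (f v) mod p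
  label-spec f u v = begin
    (φ p G f u v + fu) % p      ≡⟨ +-cong-mod (%-mod (p + fv ∸ fu)) refl ⟩
    (p + fv ∸ fu + fu) % p      ≡⟨ cong (_% p) (m∸n+n≡m (≤-trans (<⇒≤ (toℕ<n (f u))) (m≤m+n p fv))) ⟩
    (p + fv) % p                ≡⟨ p+-mod fv ⟩
    fv % p                      ∎
    where
    open ≡-Reasoning
    fu = toℕ (f u)
    fv = toℕ (f v)

  label<p : ∀ f u v → φ p G f u v < p
  label<p f u v = m%n<n _ p

  label-unique : ∀ f {u v r} → r < p → r + toℕ (f u) ≡ toℕ (f v) mod p → φ p G f u v ≡ r
  label-unique f {u} {v} r<p e =
    mod-injective (label<p f u v) r<p (+-cancelʳ-mod (toℕ (f u)) (trans (label-spec f u v) (sym e)))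

  label-shift : ∀ {f f′ u v du dv} →
    toℕ (f′ u) ≡ toℕ (f u) + du mod p → toℕ (f′ v) ≡ toℕ (f v) + dv mod p →
    du ≤ φ p G f u v + dv → φ p G f u v + dv < p + du →
    φ p G f′ u v + du ≡ φ p G f u v + dv
  label-shift {f} {f′} {u} {v} {du} {dv} f′u f′v du≤ <p+du =
    trans (cong (_+ du) (label-unique f′ r<p spec)) r+du
    where
    open ≡-Reasoning
    ℓ = φ p G f u v
    r = ℓ + dv ∸ du
    r+du : r + du ≡ ℓ + dv
    r+du = m∸n+n≡m du≤
    r<p : r < p
    r<p = m<n+o⇒m∸n<o (ℓ + dv) du (subst (ℓ + dv <_) (+-comm p du) <p+du)
    spec : r + toℕ (f′ u) ≡ toℕ (f′ v) mod p
    spec = begin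
      (r + toℕ (f′ u)) % p           ≡⟨ +-cong-mod {a = r} refl f′u ⟩
      (r + (toℕ (f u) + du)) % p     ≡⟨ cong (_% p) (x∙yz≈xz∙y r (toℕ (f u)) du) ⟩
      (r + du + toℕ (f u)) % p       ≡⟨ cong (λ x → (x + toℕ (f u)) % p) r+du ⟩
      (ℓ + dv + toℕ (f u)) % p       ≡⟨ cong (_% p) (xy∙z≈xz∙y ℓ dv (toℕ (f u))) ⟩
      (ℓ + toℕ (f u) + dv) % p       ≡⟨ +-cong-mod (label-spec f u v) refl ⟩
      (toℕ (f v) + dv) % p           ≡⟨ sym f′v ⟩
      toℕ (f′ v) % p                 ∎

  label-≤ : ∀ f {u v} → toℕ (f u) ≤ toℕ (f v) → φ p G f u v ≡ toℕ (f v) ∸ toℕ (f u)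
  label-≤ f {u} {v} fu≤fv =
    label-unique f (≤-<-trans (m∸n≤m (toℕ (f v)) (toℕ (f u))) (toℕ<n (f v))) (cong (_% p) (m∸n+n≡m fu≤fv))

  label-> : ∀ f {u v} → toℕ (f v) < toℕ (f u) → φ p G f u v ≡ p ∸ (toℕ (f u) ∸ toℕ (f v))
  label-> f {u} {v} fv<fu = label-unique f (∸-monoʳ-< (m<n⇒0<n∸m fv<fu) d≤p) (begin
    (p ∸ d + fu) % p        ≡⟨ cong (λ x → (p ∸ d + x) % p) (sym (m∸n+n≡m (<⇒≤ fv<fu))) ⟩
    (p ∸ d + (d + fv)) % p  ≡⟨ cong (_% p) (sym (+-assoc (p ∸ d) d fv)) ⟩
    (p ∸ d + d + fv) % p    ≡⟨ cong (λ x → (x + fv) % p) (m∸n+n≡m d≤p) ⟩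
    (p + fv) % p            ≡⟨ p+-mod fv ⟩
    fv % p                  ∎)
    where
    open ≡-Reasoning
    fu = toℕ (f u)
    fv = toℕ (f v)
    d = fu ∸ fv
    d≤p : d ≤ p
    d≤p = ≤-trans (m∸n≤m fu fv) (<⇒≤ (toℕ<n (f u)))

  pq-label-bounds : ∀ {q f} → IsPQColouring p q G f →
    ∀ {u v} → Arc G u v ≡ true → q ≤ φ p G f u v × φ p G f u v + q ≤ p
  pq-label-bounds {q} {f} pq {u} {v} uv with pq u v uv | toℕ (f u) ≤? toℕ (f v)
  ... | q≤d , q+d≤p | yes fu≤fv rewrite m≤n⇒∣m-n∣≡n∸m fu≤fv | label-≤ f fu≤fv =
    q≤d , subst (_≤ p) (+-comm q _) q+d≤p
  ... | q≤d , q+d≤p | no fu≰fv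
    rewrite m≤n⇒∣n-m∣≡n∸m (<⇒≤ (≰⇒> fu≰fv)) | label-> f (≰⇒> fu≰fv) =
    m+n≤o⇒m≤o∸n q q+d≤p , (begin
      p ∸ d + q  ≤⟨ +-monoʳ-≤ (p ∸ d) q≤d ⟩
      p ∸ d + d  ≡⟨ m∸n+n≡m (≤-trans (m≤n+m d q) q+d≤p) ⟩
      p          ∎)
    where
    open ≤-Reasoning
    d = toℕ (f u) ∸ toℕ (f v)

  stepValue-arc : ∀ f {u v} → Arc G u v ≡ true → stepValue p G f (u , v) ≡ φ p G f u v
  stepValue-arc f uv rewrite uv = refl

  arc⇒adj : ∀ {u v} → Arc G u v ≡ true → Adj G u v
  arc⇒adj uv rewrite uv = refl

  ¬adj-refl : ∀ {v} → ¬ Adj G v v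
  ¬adj-refl {v} = subst (λ b → ¬ (b ∨ b) ≡ true) (sym (loopless G v)) λ ()

  labelSum : Colouring p G → List (Fin (n G) × Fin (n G)) → ℕ
  labelSum f es = sum (map (stepValue p G f) es)

  labelSum-++ : ∀ f xs ys → labelSum f (xs ++ ys) ≡ labelSum f xs + labelSum f ys
  labelSum-++ f xs ys = trans (cong sum (map-++ (stepValue p G f) xs ys)) (sum-++ (map (stepValue p G f) xs) _)

  labelSum-split : ∀ f xs y ys zs →
    labelSum f (closedPairs (xs ++ y ∷ ys ++ y ∷ zs))
      ≡ labelSum f (closedPairs (y ∷ ys)) + labelSum f (closedPairs (xs ++ y ∷ zs))
  labelSum-split f xs y ys zs =
    trans (sum-↭ (map⁺ (stepValue p G f) (closedPairs-split xs y ys zs))) (labelSum-++ f (closedPairs (y ∷ ys)) _)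

  labelSum-twoCycle : ∀ f {u v} → Adj G u v → labelSum f (closedPairs (u ∷ v ∷ [])) ≡ p
  labelSum-twoCycle f {u} {v} adj with Arc G u v in uv | Arc G v u in vu
  ... | true  | true  with () ← trans (sym vu) (oriented G u v uv)
  ... | true  | false = trans (cong (φ p G f u v +_) (+-identityʳ _)) (m+[n∸m]≡n (<⇒≤ (label<p f u v)))
  ... | false | true  = trans (cong (p ∸ φ p G f v u +_) (+-identityʳ _)) (m∸n+n≡m (<⇒≤ (label<p f v u)))

  shift-preserves-labels : ∀ {f f′ k} → (∀ v → toℕ (f′ v) ≡ (toℕ (f v) + k) % p) →
    ∀ u v → φ p G f′ u v ≡ φ p G f u v
  shift-preserves-labels {f} {f′} {k} f′≡f+k u v =
    +-cancelʳ-≡ k _ _ (label-shift {f} {f′} (shifted u) (shifted v) (m≤n+m k _) (+-monoˡ-< k (label<p f u v)))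
    where
    shifted : ∀ w → toℕ (f′ w) ≡ toℕ (f w) + k mod p
    shifted w = trans (cong (_% p) (f′≡f+k w)) (%-mod _)

  shift-preserves-φCycle : ∀ {f f′ k} → (∀ v → toℕ (f′ v) ≡ (toℕ (f v) + k) % p) →
    ∀ C → φCycle p G f′ C ≡ φCycle p G f C
  shift-preserves-φCycle {f} {f′} f′≡f+k C = cong sum (map-cong same-stepValue (closedPairs C))
    where
    same-stepValue : ∀ e → stepValue p G f′ e ≡ stepValue p G f e
    same-stepValue (u , v)
      rewrite shift-preserves-labels {f} f′≡f+k u v | shift-preserves-labels {f} f′≡f+k v u = refl

  SameLabels : Colouring p G → Colouring p G → Set
  SameLabels f g = ∀ {u v} → Arc G u v ≡ true → φ p G f u v ≡ φ p G g u v

  sameLabels⇒shift : Connected G → Fin (n G) → ∀ {f g} → SameLabels f g →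
    ∃[ k ] ∀ v → toℕ (g v) ≡ (toℕ (f v) + k) % p
  sameLabels⇒shift connected r {f} {g} same =
    k , λ v → trans (sym (m<n⇒m%n≡m (toℕ<n (g v)))) (transport (connected r v) at-root)
    where
    open ≡-Reasoning
    k = p ∸ toℕ (f r) + toℕ (g r)
    Shifted : Fin (n G) → Set
    Shifted x = toℕ (g x) ≡ toℕ (f x) + k mod p
    at-root : Shifted r
    at-root = begin
      toℕ (g r) % p                                  ≡⟨ sym (p+-mod (toℕ (g r))) ⟩
      (p + toℕ (g r)) % p                            ≡⟨ cong (λ x → (x + toℕ (g r)) % p) (sym fr+[p∸fr]≡p) ⟩
      (toℕ (f r) + (p ∸ toℕ (f r)) + toℕ (g r)) % p  ≡⟨ cong (_% p) (+-assoc (toℕ (f r)) _ _) ⟩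
      (toℕ (f r) + k) % p                            ∎
      where
      fr+[p∸fr]≡p : toℕ (f r) + (p ∸ toℕ (f r)) ≡ p
      fr+[p∸fr]≡p = m+[n∸m]≡n (<⇒≤ (toℕ<n (f r)))
    step : ∀ {a b} → Adj G a b → Shifted a → Shifted b
    step {a} {b} adj ga≡fa+k with Arc G a b in ab
    ... | true = begin
      toℕ (g b) % p                       ≡⟨ sym (label-spec g a b) ⟩
      (φ p G g a b + toℕ (g a)) % p       ≡⟨ +-cong-mod {a = φ p G g a b} refl ga≡fa+k ⟩
      (φ p G g a b + (toℕ (f a) + k)) % p ≡⟨ cong (λ x → (x + (toℕ (f a) + k)) % p) (sym (same ab)) ⟩
      (φ p G f a b + (toℕ (f a) + k)) % p ≡⟨ cong (_% p) (sym (+-assoc (φ p G f a b) _ _)) ⟩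
      (φ p G f a b + toℕ (f a) + k) % p   ≡⟨ +-cong-mod (label-spec f a b) refl ⟩
      (toℕ (f b) + k) % p                 ∎
    ... | false = +-cancelʳ-mod (φ p G g b a) (begin
      (toℕ (g b) + φ p G g b a) % p       ≡⟨ cong (_% p) (+-comm (toℕ (g b)) _) ⟩
      (φ p G g b a + toℕ (g b)) % p       ≡⟨ label-spec g b a ⟩
      toℕ (g a) % p                       ≡⟨ ga≡fa+k ⟩
      (toℕ (f a) + k) % p                 ≡⟨ +-cong-mod (sym (label-spec f b a)) refl ⟩
      (φ p G f b a + toℕ (f b) + k) % p   ≡⟨ cong (λ x → (x + toℕ (f b) + k) % p) (same adj) ⟩
      (φ p G g b a + toℕ (f b) + k) % p   ≡⟨ cong (_% p) (xy∙z≈yz∙x (φ p G g b a) _ _) ⟩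
      (toℕ (f b) + k + φ p G g b a) % p   ∎)
    transport : ∀ {a b} → Star (Adj G) a b → Shifted a → Shifted b
    transport ε        sa = sa
    transport (e ◅ es) sa = transport es (step e sa)

  shiftOf : ∀ {q f f′} → VertexSetRecolouring p q G f f′ → Fin (n G) → ℕ
  shiftOf (X , α , _) v = if X v then α else 0

  recoloured-colour : ∀ {q f f′} (rec : VertexSetRecolouring p q G f f′) →
    ∀ v → toℕ (f′ v) ≡ toℕ (f v) + shiftOf rec v mod p
  recoloured-colour (X , α , _ , _ , _ , _ , _ , _ , colour) v with X v | colour v
  ... | true  | f′v = trans (cong (_% p) f′v) (%-mod _)
  ... | false | f′v = cong (_% p) (trans f′v (sym (+-identityʳ _)))

  recoloured-slack : ∀ {q f f′} → 1 ≤ q → (rec : VertexSetRecolouring p q G f f′) →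
    ∀ {u v} → Arc G u v ≡ true →
    shiftOf rec u ≤ φ p G f u v + shiftOf rec v × φ p G f u v + shiftOf rec v < p + shiftOf rec u
  recoloured-slack {q} {f} q≥1 (X , α , _ , _ , _ , _ , leaving , entering , _) {u} {v} uv
    with X u in xu | X v in xv
  ... | true  | true  = m≤n+m α _ , +-monoˡ-< α (label<p f u v)
  ... | false | false = z≤n , +-monoˡ-< 0 (label<p f u v)
  ... | true  | false =
    ≤-trans (m≤n+m α q) (≤-trans (leaving u v uv xu xv) (m≤m+n _ 0)) ,
    ≤-trans (+-monoˡ-< 0 (label<p f u v)) (+-monoʳ-≤ p z≤n)
  ... | false | true  = z≤n , (begin-strict
    φ p G f u v + α      <⟨ +-monoˡ-< α (m<m+n _ q≥1) ⟩
    φ p G f u v + q + α  ≤⟨ entering u v uv xu xv ⟩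
    p                    ≡⟨ sym (+-identityʳ p) ⟩
    p + 0                ∎)
    where open ≤-Reasoning

  recoloured-label : ∀ {q f f′} → 1 ≤ q → (rec : VertexSetRecolouring p q G f f′) →
    ∀ {u v} → Arc G u v ≡ true → φ p G f′ u v + shiftOf rec u ≡ φ p G f u v + shiftOf rec v
  recoloured-label {f = f} {f′} q≥1 rec {u} {v} uv =
    label-shift {f} {f′} (recoloured-colour rec u) (recoloured-colour rec v) (proj₁ slack) (proj₂ slack)
    where slack = recoloured-slack q≥1 rec uv

  recoloured-stepValue : ∀ {q f f′} → 1 ≤ q → (rec : VertexSetRecolouring p q G f f′) →
    ∀ {u v} → Adj G u v → stepValue p G f′ (u , v) + shiftOf rec u ≡ stepValue p G f (u , v) + shiftOf rec v
  recoloured-stepValue {f = f} {f′} q≥1 rec {u} {v} adj with Arc G u v in uv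
  ... | true  = recoloured-label q≥1 rec uv
  ... | false = complement-exchange (recoloured-label q≥1 rec adj) (<⇒≤ (label<p f′ v u)) (<⇒≤ (label<p f v u))

  recolouring-preserves-φCycle : ∀ {q f f′} → 1 ≤ q → VertexSetRecolouring p q G f f′ →
    ∀ C → IsCycle G C → φCycle p G f C ≡ φCycle p G f′ C
  recolouring-preserves-φCycle {f = f} {f′} q≥1 rec C (_ , _ , adjacent) =
    sym (sum-closedPairs-telescope (stepValue p G f) (stepValue p G f′) (shiftOf rec) C
      (All.map (λ {e} → recoloured-stepValue q≥1 rec {proj₁ e} {proj₂ e}) adjacent))

  reaches-preserves-φCycle : ∀ {q f h} → 1 ≤ q → Reaches p q G f h →
    ∀ C → IsCycle G C → φCycle p G f C ≡ φCycle p G h C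
  reaches-preserves-φCycle q≥1 ε           C cycle = refl
  reaches-preserves-φCycle q≥1 (rec ◅ recs) C cycle =
    trans (recolouring-preserves-φCycle q≥1 rec C cycle) (reaches-preserves-φCycle q≥1 recs C cycle)

  Balanced : Colouring p G → Colouring p G → (Fin (n G) → ℕ) → Set
  Balanced g f h = ∀ {u v} → Arc G u v ≡ true → φ p G g u v + h u ≡ φ p G f u v + h v

  module CycleCondition (f g : Colouring p G)
    (cycles-agree : ∀ C → IsCycle G C → φCycle p G f C ≡ φCycle p G g C) where

    closedWalk-labelSum : ∀ C → All (uncurry (Adj G)) (closedPairs C) →
      labelSum f (closedPairs C) ≡ labelSum g (closedPairs C)
    closedWalk-labelSum C = go C (n<1+n (length C))
      where
      simple : ∀ C → Unique C → All (uncurry (Adj G)) (closedPairs C) →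
        labelSum f (closedPairs C) ≡ labelSum g (closedPairs C)
      simple []               _      _         = refl
      simple (x ∷ [])         _      (xx ∷ []) = ⊥-elim (¬adj-refl xx)
      simple (x ∷ y ∷ [])     _      (xy ∷ _)  = trans (labelSum-twoCycle f xy) (sym (labelSum-twoCycle g xy))
      simple C@(_ ∷ _ ∷ _ ∷ _) unique adjacent = cycles-agree C (s≤s (s≤s (s≤s z≤n)) , unique , adjacent)

      go : ∀ {k} C → length C < k → All (uncurry (Adj G)) (closedPairs C) →
        labelSum f (closedPairs C) ≡ labelSum g (closedPairs C)
      go {suc k} C (s≤s |C|≤k) adjacent with unique⊎repeats Data.Fin._≟_ C
      ... | inj₁ unique = simple C unique adjacent
      ... | inj₂ (xs , y , ys , zs , refl) = begin
        labelSum f (closedPairs (xs ++ y ∷ ys ++ y ∷ zs))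
          ≡⟨ labelSum-split f xs y ys zs ⟩
        labelSum f (closedPairs (y ∷ ys)) + labelSum f (closedPairs (xs ++ y ∷ zs))
          ≡⟨ cong₂ _+_ (go (y ∷ ys) |loop|<k (proj₁ parts)) (go (xs ++ y ∷ zs) |rest|<k (proj₂ parts)) ⟩
        labelSum g (closedPairs (y ∷ ys)) + labelSum g (closedPairs (xs ++ y ∷ zs))
          ≡⟨ sym (labelSum-split g xs y ys zs) ⟩
        labelSum g (closedPairs (xs ++ y ∷ ys ++ y ∷ zs)) ∎
        where
        open ≡-Reasoning
        parts = ++⁻ (closedPairs (y ∷ ys)) (All-resp-↭ (closedPairs-split xs y ys zs) adjacent)
        |rest|>0 : 0 < length (xs ++ y ∷ zs)
        |rest|>0 = subst (0 <_) (sym (length-++-sucʳ xs y zs)) z<s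
        |loop|<k : length (y ∷ ys) < k
        |loop|<k = <-≤-trans (subst (length (y ∷ ys) <_) (sym (length-split xs y ys zs)) (m<m+n _ |rest|>0)) |C|≤k
        |rest|<k : length (xs ++ y ∷ zs) < k
        |rest|<k = <-≤-trans (subst (length (xs ++ y ∷ zs) <_) (sym (length-split xs y ys zs)) (m<n+m _ z<s)) |C|≤k

    closedPath-labelSum : ∀ {x} (c : Star (Adj G) x x) → labelSum f (edges c) ≡ labelSum g (edges c)
    closedPath-labelSum c =
      subst (λ es → labelSum f es ≡ labelSum g es) (closedPairs-vertices c)
        (closedWalk-labelSum (vertices c) (subst (All _) (sym (closedPairs-vertices c)) (edges-related c)))

    roundTrip-labelSum : ∀ {x y} (s : Star (Adj G) x y) (t : Star (Adj G) y x) →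
      labelSum f (edges s) + labelSum f (edges t) ≡ labelSum g (edges s) + labelSum g (edges t)
    roundTrip-labelSum s t = begin
      labelSum f (edges s) + labelSum f (edges t)  ≡⟨ sym (labelSum-++ f (edges s) (edges t)) ⟩
      labelSum f (edges s ++ edges t)              ≡⟨ cong (labelSum f) (sym (edges-◅◅ s t)) ⟩
      labelSum f (edges (s ◅◅ t))                  ≡⟨ closedPath-labelSum (s ◅◅ t) ⟩
      labelSum g (edges (s ◅◅ t))                  ≡⟨ cong (labelSum g) (edges-◅◅ s t) ⟩
      labelSum g (edges s ++ edges t)              ≡⟨ labelSum-++ g (edges s) (edges t) ⟩
      labelSum g (edges s) + labelSum g (edges t)  ∎
      where open ≡-Reasoning

    module Potential (connected : Connected G) (r : Fin (n G)) where

      outward inward : Colouring p G → Fin (n G) → ℕ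
      outward h x = labelSum h (edges (connected r x))
      inward  h x = labelSum h (edges (connected x r))

      K : ℕ
      K = proj₁ (∃-upper-bound (outward f))

      -- outward g − outward f, shifted by K to stay in ℕ
      potential : Fin (n G) → ℕ
      potential x = outward g x + (K ∸ outward f x)

      potential-balanced : Balanced g f potential
      potential-balanced {u} {v} uv =
        potential-arith (φ p G f u v) (φ p G g u v) (outward f u) (outward g u) (outward f v) (outward g v)
          (inward f v) (inward g v) (K ∸ outward f u) (K ∸ outward f v)
        (begin
          outward f u + (φ p G f u v + inward f v)
            ≡⟨ cong (λ ℓ → outward f u + (ℓ + inward f v)) (sym (stepValue-arc f uv)) ⟩
          outward f u + labelSum f (edges (arc ◅ back))
            ≡⟨ roundTrip-labelSum (connected r u) (arc ◅ back) ⟩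
          outward g u + labelSum g (edges (arc ◅ back))
            ≡⟨ cong (λ ℓ → outward g u + (ℓ + inward g v)) (stepValue-arc g uv) ⟩
          outward g u + (φ p G g u v + inward g v) ∎)
        (roundTrip-labelSum (connected r v) back)
        (trans (m∸n+n≡m (below u)) (sym (m∸n+n≡m (below v))))
        where
        open ≡-Reasoning
        arc = arc⇒adj uv
        back = connected v r
        below : ∀ x → outward f x ≤ K
        below = proj₂ (∃-upper-bound (outward f))

  balanced-constant : ∀ {g f h c} → Balanced g f h → (∀ v → h v ≡ c) → SameLabels g f
  balanced-constant {g} {f} {h} {c} balanced constant {u} {v} uv = +-cancelʳ-≡ c _ _ (begin
    φ p G g u v + c    ≡⟨ cong (φ p G g u v +_) (sym (constant u)) ⟩
    φ p G g u v + h u  ≡⟨ balanced uv ⟩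
    φ p G f u v + h v  ≡⟨ cong (φ p G f u v +_) (constant v) ⟩
    φ p G f u v + c    ∎)
    where open ≡-Reasoning

  balanced-recolour : ∀ {q g f f′ h} → 1 ≤ q → Balanced g f h → (rec : VertexSetRecolouring p q G f f′) →
    (∀ v → shiftOf rec v ≤ h v) → Balanced g f′ (λ v → h v ∸ shiftOf rec v)
  balanced-recolour {g = g} {f} {f′} {h} q≥1 balanced rec fits {u} {v} uv = +-cancelʳ-≡ (s u) _ _ (begin
    φ p G g u v + (h u ∸ s u) + s u      ≡⟨ +-assoc (φ p G g u v) _ (s u) ⟩
    φ p G g u v + (h u ∸ s u + s u)      ≡⟨ cong (φ p G g u v +_) (m∸n+n≡m (fits u)) ⟩
    φ p G g u v + h u                    ≡⟨ balanced uv ⟩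
    φ p G f u v + h v                    ≡⟨ cong (φ p G f u v +_) (sym (m∸n+n≡m (fits v))) ⟩
    φ p G f u v + (h v ∸ s v + s v)      ≡⟨ x∙yz≈xz∙y (φ p G f u v) _ (s v) ⟩
    φ p G f u v + s v + (h v ∸ s v)      ≡⟨ cong (_+ (h v ∸ s v)) (sym (recoloured-label q≥1 rec uv)) ⟩
    φ p G f′ u v + s u + (h v ∸ s v)     ≡⟨ xy∙z≈xz∙y (φ p G f′ u v) (s u) _ ⟩
    φ p G f′ u v + (h v ∸ s v) + s u     ∎)
    where
    open ≡-Reasoning
    s = shiftOf rec

  module Descent {q : ℕ} (q≥1 : 1 ≤ q) (p≥2 : 2 ≤ p) (g : Colouring p G)
    (g-bounds : ∀ {u v} → Arc G u v ≡ true → q ≤ φ p G g u v × φ p G g u v + q ≤ p) where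

    lower-top : ∀ {B f h} → Balanced g f h → (∀ v → h v ≤ suc B) →
      (∃[ v ] h v ≡ suc B) → (∃[ w ] h w ≢ suc B) →
      ∃[ f′ ] VertexSetRecolouring p q G f f′ × ∃[ h′ ] (∀ v → h′ v ≤ B) × Balanced g f′ h′
    lower-top {B} {f} {h} balanced h≤ (v₀ , v₀-top) (w₀ , w₀-low) =
      f′ , rec , _ , lowered , balanced-recolour {g = g} q≥1 balanced rec fits
      where
      X : Fin (n G) → Bool
      X v = h v ≡ᵇ suc B

      top : ∀ {v} → X v ≡ true → h v ≡ suc B
      top {v} X≡true = ≡ᵇ⇒≡ (h v) (suc B) (subst T (sym X≡true) tt)

      low : ∀ {v} → X v ≡ false → h v ≤ B
      low {v} X≡false = ≤-pred (≤∧≢⇒< (h≤ v) (λ h≡ → subst T X≡false (≡⇒≡ᵇ (h v) (suc B) h≡)))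

      increment : Fin p → Fin p
      increment c = fromℕ< (m%n<n (toℕ c + 1) p)

      f′ : Colouring p G
      f′ v = if X v then increment (f v) else f v

      colour : ∀ v → toℕ (f′ v) ≡ (if X v then (toℕ (f v) + 1) % p else toℕ (f v))
      colour v with X v
      ... | true  = toℕ-fromℕ< _
      ... | false = refl

      leaving : ∀ u v → Arc G u v ≡ true → X u ≡ true → X v ≡ false → q + 1 ≤ φ p G f u v
      leaving u v uv Xu Xv = begin
        q + 1              ≡⟨ +-comm q 1 ⟩
        suc q              ≤⟨ s≤s (proj₁ (g-bounds uv)) ⟩
        suc (φ p G g u v)  ≤⟨ g<f ⟩
        φ p G f u v        ∎
        where
        open ≤-Reasoning
        g<f : φ p G g u v < φ p G f u v
        g<f = m+1+o≡n+k⇒k≤o⇒m<n (subst (λ x → φ p G g u v + x ≡ φ p G f u v + h v) (top Xu) (balanced uv))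
                (low Xv)

      entering : ∀ u v → Arc G u v ≡ true → X u ≡ false → X v ≡ true → φ p G f u v + q + 1 ≤ p
      entering u v uv Xu Xv = begin
        φ p G f u v + q + 1    ≡⟨ +-comm (φ p G f u v + q) 1 ⟩
        suc (φ p G f u v) + q  ≤⟨ +-monoˡ-≤ q f<g ⟩
        φ p G g u v + q        ≤⟨ proj₂ (g-bounds uv) ⟩
        p                      ∎
        where
        open ≤-Reasoning
        f<g : φ p G f u v < φ p G g u v
        f<g = m+1+o≡n+k⇒k≤o⇒m<n (sym (subst (λ x → φ p G g u v + h u ≡ φ p G f u v + x) (top Xv) (balanced uv)))
                (low Xu)

      rec : VertexSetRecolouring p q G f f′
      rec = X , 1 , (v₀ , dec-true (h v₀ ≟ suc B) v₀-top) , (w₀ , dec-false (h w₀ ≟ suc B) w₀-low) ,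
            ≤-refl , p≥2 , leaving , entering , colour

      fits : ∀ v → shiftOf rec v ≤ h v
      fits v with X v in Xv
      ... | true  = subst (1 ≤_) (sym (top Xv)) (s≤s z≤n)
      ... | false = z≤n

      lowered : ∀ v → h v ∸ shiftOf rec v ≤ B
      lowered v with X v in Xv
      ... | true  = ≤-reflexive (cong (_∸ 1) (top Xv))
      ... | false = low Xv

    descend : ∀ B {f} h → (∀ v → h v ≤ B) → Balanced g f h → ∃[ f′ ] Reaches p q G f f′ × SameLabels g f′
    descend zero {f} h h≤0 balanced = f , ε , balanced-constant {g} {f} balanced (λ v → n≤0⇒n≡0 (h≤0 v))
    descend (suc B) {f} h h≤ balanced with all? (λ v → h v ≟ suc B)
    ... | yes all-top = f , ε , balanced-constant {g} {f} balanced all-top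
    ... | no ¬all-top with any? (λ v → h v ≟ suc B)
    ...   | no ¬top = descend B h (λ v → ≤-pred (≤∧≢⇒< (h≤ v) (λ h≡ → ¬top (v , h≡)))) balanced
    ...   | yes top with lower-top balanced h≤ top (¬∀⟶∃¬ _ _ (λ v → h v ≟ suc B) ¬all-top)
    ...     | f′ , rec , h′ , h′≤B , balanced′ with descend B h′ h′≤B balanced′
    ...       | f″ , f′→f″ , same = f″ , rec ◅ f′→f″ , same

  shift-reachable⇒cycles-agree : ∀ {q f g} → 1 ≤ q →
    (Σ (Colouring p G) λ h → Reaches p q G f h × Σ ℕ λ k → ∀ v → toℕ (h v) ≡ (toℕ (g v) + k) % p) →
    ∀ C → IsCycle G C → φCycle p G f C ≡ φCycle p G g C
  shift-reachable⇒cycles-agree {g = g} q≥1 (h , f→h , k , h≡g+k) C cycle =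
    trans (reaches-preserves-φCycle q≥1 f→h C cycle) (shift-preserves-φCycle {g} h≡g+k C)

  cycles-agree⇒shift-reachable : ∀ {q f g} → 1 ≤ q → 2 ≤ p → Connected G → IsPQColouring p q G g →
    (∀ C → IsCycle G C → φCycle p G f C ≡ φCycle p G g C) →
    Σ (Colouring p G) λ h → Reaches p q G f h × Σ ℕ λ k → ∀ v → toℕ (h v) ≡ (toℕ (g v) + k) % p
  cycles-agree⇒shift-reachable {f = f} {g} q≥1 p≥2 connected g-pq cycles-agree with inhabited⊎empty (n G)
  ... | inj₂ no-vertex = f , ε , 0 , λ v → ⊥-elim (no-vertex v)
  ... | inj₁ r =
    let B , bound = ∃-upper-bound potential
        f′ , f→f′ , same = descend B potential bound potential-balanced
    in f′ , f→f′ , sameLabels⇒shift connected r same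
    where
    open CycleCondition f g cycles-agree
    open Potential connected r
    open Descent q≥1 p≥2 g (pq-label-bounds {f = g} g-pq)

corollary2p5 : (p q : ℕ) .{{_ : NonZero p}} → 1 ≤ q → 2 * q ≤ p →
    (G : OrientedGraph) → Connected G →
    (f g : Colouring p G) → IsPQColouring p q G f → IsPQColouring p q G g →
    (Σ (Colouring p G) λ h → Reaches p q G f h ×
       Σ ℕ λ k → ∀ v → toℕ (h v) ≡ (toℕ (g v) + k) % p)
    ⇔ (∀ (C : List (Fin (n G))) → IsCycle G C → φCycle p G f C ≡ φCycle p G g C)
-- Only g needs to be a (p,q)-colouring: its labels provide the slack for every recolouring step.
corollary2p5 p q q≥1 2q≤p G connected f g _ g-pq =
  mk⇔ (shift-reachable⇒cycles-agree p G q≥1)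
      (cycles-agree⇒shift-reachable p G q≥1 (≤-trans (*-monoʳ-≤ 2 q≥1) 2q≤p) connected g-pq)
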